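{- Let $X$ be a spectral locale and $(k_i)_{i:I}$ a small family ($I:\mathcal{U}$) of Scott continuous nuclei on $X$. Then the map $U \mapsto \bigvee_{s : \mathrm{List}(I)} k^*_s(U)$ is a Scott continuous nucleus on $X$, and it is the least upper bound of $(k_i)_{i:I}$ in the poset of Scott continuous nuclei on $X$ ordered pointwise.
   Context: Setting: univalent type theory with universes, function and propositional extensionality, propositional truncations. Fix base universe $\mathcal{U}$; small means equivalent to a type in $\mathcal{U}$. A frame has carrier in $\mathcal{U}^+$, an $\Omega_{\mathcal{U}}$-valued partial order, top, binary meets, joins of families indexed by types in $\mathcal{U}$, with meets distributing over joins; a locale $X$ has frame $\mathcal{O}(X)$. An open $U$ is compact if for every small directed family $(V_i)$ with $U\le\bigvee V_i$ there exists $i$ with $U\le V_i$. $X$ is spectral if its top is compact, compact opens are closed under binary meets, every open is (unspecified) a join of a small directed family of compact opens, and the type of compact opens is small. A nucleus on $X$ is an endomap $j$ of $\mathcal{O}(X)$ that is inflationary ($U\le j(U)$), preserves binary meets, and is idempotent; it is Scott continuous if it preserves joins of small directed families. Nuclei are ordered pointwise. For a list $s=(i_0,\dots,i_{n-1})$ of indices, $k^*_s := k_{i_{n-1}}\circ\cdots\circ k_{i_0}$, with $k^*_{()}$ the identity. -}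

module Defs where

open import Level using (Level; _⊔_) renaming (suc to lsuc)
open import Data.Product using (Σ; _×_; _,_; proj₁)
open import Data.List using (List; []; _∷_)
open import Function using (_∘_; id)
open import Function.Bundles using (_↔_)
open import Relation.Binary.PropositionalEquality using (_≡_)

isProp : ∀ {a} → Set a → Set a
isProp A = (x y : A) → x ≡ y

-- Propositional truncation, impredicative encoding: eliminates into
-- propositions of the base universe Set u (i.e. into Ω_U).
∥_∥⟨_⟩ : ∀ {a} → Set a → (u : Level) → Set (a ⊔ lsuc u)
∥ A ∥⟨ u ⟩ = (P : Set u) → isProp P → (A → P) → P

record Frame (u : Level) : Set (lsuc (lsuc u)) where
  infix 4 _≤_
  infixr 7 _∧_
  field
    Carrier  : Set (lsuc u)
    _≤_      : Carrier → Carrier → Set u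
    ≤-prop   : ∀ x y → isProp (x ≤ y)
    ≤-refl   : ∀ x → x ≤ x
    ≤-trans  : ∀ {x y z} → x ≤ y → y ≤ z → x ≤ z
    ≤-antisym : ∀ {x y} → x ≤ y → y ≤ x → x ≡ y
    ⊤        : Carrier
    ⊤-top    : ∀ x → x ≤ ⊤
    _∧_      : Carrier → Carrier → Carrier
    ∧-lowerˡ : ∀ x y → x ∧ y ≤ x
    ∧-lowerʳ : ∀ x y → x ∧ y ≤ y
    ∧-greatest : ∀ {x y z} → z ≤ x → z ≤ y → z ≤ x ∧ y
    ⋁        : {I : Set u} → (I → Carrier) → Carrier
    ⋁-upper  : ∀ {I : Set u} (V : I → Carrier) (i : I) → V i ≤ ⋁ V
    ⋁-least  : ∀ {I : Set u} (V : I → Carrier) {x} → (∀ i → V i ≤ x) → ⋁ V ≤ x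
    distrib  : ∀ x {I : Set u} (V : I → Carrier) → x ∧ ⋁ V ≡ ⋁ (λ i → x ∧ V i)

record Locale (u : Level) : Set (lsuc (lsuc u)) where
  field
    𝒪 : Frame u

module _ {u : Level} (X : Locale u) where
  open Locale X
  open Frame 𝒪

  isDirected : {I : Set u} → (I → Carrier) → Set (lsuc u)
  isDirected {I} V =
    ∥ I ∥⟨ u ⟩ × (∀ i j → ∥ Σ I (λ k → (V i ≤ V k) × (V j ≤ V k)) ∥⟨ u ⟩)

  isCompact : Carrier → Set (lsuc u)
  isCompact U = (I : Set u) (V : I → Carrier) → isDirected V →
                U ≤ ⋁ V → ∥ Σ I (λ i → U ≤ V i) ∥⟨ u ⟩

  CompactOpen : Set (lsuc u)
  CompactOpen = Σ Carrier isCompact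

  record isSpectral : Set (lsuc (lsuc u)) where
    field
      ⊤-compact : isCompact ⊤
      ∧-compact : ∀ U V → isCompact U → isCompact V → isCompact (U ∧ V)
      basis     : ∀ U → ∥ Σ (Set u) (λ I → Σ (I → Carrier) (λ W →
                     isDirected W × (∀ i → isCompact (W i)) × (U ≡ ⋁ W))) ∥⟨ u ⟩
      small     : Σ (Set u) (λ B → B ↔ CompactOpen)

  record isNucleus (j : Carrier → Carrier) : Set (lsuc u) where
    field
      inflationary : ∀ U → U ≤ j U
      preserves-∧  : ∀ U V → j (U ∧ V) ≡ j U ∧ j V
      idempotent   : ∀ U → j (j U) ≡ j U

  isScottContinuous : (Carrier → Carrier) → Set (lsuc u)
  isScottContinuous j = (I : Set u) (V : I → Carrier) → isDirected V →
                        j (⋁ V) ≡ ⋁ (j ∘ V)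

  record ScottContinuousNucleus : Set (lsuc (lsuc u)) where
    field
      fun        : Carrier → Carrier
      nucleus    : isNucleus fun
      continuous : isScottContinuous fun

  _≼_ : (Carrier → Carrier) → (Carrier → Carrier) → Set (lsuc u)
  j ≼ k = ∀ U → j U ≤ k U

  -- k*_s = k_{i_{n-1}} ∘ ... ∘ k_{i_0}, k*_[] = id
  iterate : {I : Set u} → (I → Carrier → Carrier) → List I → Carrier → Carrier
  iterate k []      = id
  iterate k (i ∷ s) = iterate k s ∘ k i

  joinOfNuclei : {I : Set u} → (I → Carrier → Carrier) → Carrier → Carrier
  joinOfNuclei {I} k U = ⋁ {List I} (λ s → iterate k s U)

{-# OPTIONS --safe #-}
-- The composites k*_s form a directed family, since s ++ t bounds both s and t
-- (nuclei are inflationary and monotone).  Scott continuity of each k_i makes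
-- every k*_t commute with directed joins, so k*_t (⋁_s k*_s U) = ⋁_s k*_{s ++ t} U,
-- which gives idempotence and Scott continuity of the join; preservation of
-- binary meets follows from distributivity together with directedness.  A
-- nucleus above every k_i absorbs each composite by idempotence, hence is above
-- the join.
module Submission where

open import Defs
open import Level using (Level) renaming (suc to lsuc)
open import Data.Product using (_×_; _,_)
open import Data.List using (List; []; _∷_; _++_)
open import Function using (_∘_)
open import Relation.Binary.Bundles using (Poset)
open import Relation.Binary.Core using (_Preserves_⟶_)
open import Relation.Binary.PropositionalEquality
  using (_≡_; _≗_; refl; sym; cong; isEquivalence)

∣_∣ : ∀ {a u} {A : Set a} → A → ∥ A ∥⟨ u ⟩
∣ a ∣ P P-prop f = f a

∥∥-map : ∀ {a b u} {A : Set a} {B : Set b} → (A → B) → ∥ A ∥⟨ u ⟩ → ∥ B ∥⟨ u ⟩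
∥∥-map f a P P-prop g = a P P-prop (g ∘ f)

module FrameProperties {u : Level} (F : Frame u) where
  open Frame F

  ≤-reflexive : ∀ {x y} → x ≡ y → x ≤ y
  ≤-reflexive {x} refl = ≤-refl x

  poset : Poset (lsuc u) (lsuc u) u
  poset = record
    { Carrier        = Carrier
    ; _≈_            = _≡_
    ; _≤_            = _≤_
    ; isPartialOrder = record
      { isPreorder = record
        { isEquivalence = isEquivalence
        ; reflexive     = ≤-reflexive
        ; trans         = ≤-trans
        }
      ; antisym    = ≤-antisym
      }
    }

  open import Relation.Binary.Reasoning.PartialOrder poset public

  x≤y⇒x∧y≡x : ∀ {x y} → x ≤ y → x ∧ y ≡ x
  x≤y⇒x∧y≡x {x} {y} x≤y = ≤-antisym (∧-lowerˡ x y) (∧-greatest (≤-refl x) x≤y)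

  ∧-comm : ∀ x y → x ∧ y ≡ y ∧ x
  ∧-comm x y = ≤-antisym (swap x y) (swap y x)
    where
    swap : ∀ x y → x ∧ y ≤ y ∧ x
    swap x y = ∧-greatest (∧-lowerʳ x y) (∧-lowerˡ x y)

  ∧-mono : ∀ {x x′ y y′} → x ≤ x′ → y ≤ y′ → x ∧ y ≤ x′ ∧ y′
  ∧-mono {x} {x′} {y} {y′} x≤x′ y≤y′ =
    ∧-greatest (≤-trans (∧-lowerˡ x y) x≤x′) (≤-trans (∧-lowerʳ x y) y≤y′)

  ⋁-mono : ∀ {I : Set u} {V W : I → Carrier} → (∀ i → V i ≤ W i) → ⋁ V ≤ ⋁ W
  ⋁-mono {W = W} V≤W = ⋁-least _ (λ i → ≤-trans (V≤W i) (⋁-upper W i))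

  ⋁-∧-⋁-least : ∀ {A B : Set u} (a : A → Carrier) (b : B → Carrier) {z} →
                (∀ s t → a s ∧ b t ≤ z) → ⋁ a ∧ ⋁ b ≤ z
  ⋁-∧-⋁-least a b {z} a∧b≤z = begin
    ⋁ a ∧ ⋁ b                  ≡⟨ distrib (⋁ a) b ⟩
    ⋁ (λ t → ⋁ a ∧ b t)        ≤⟨ ⋁-least _ column≤z ⟩
    z                          ∎
    where
    column≤z : ∀ t → ⋁ a ∧ b t ≤ z
    column≤z t = begin
      ⋁ a ∧ b t                ≡⟨ ∧-comm (⋁ a) (b t) ⟩
      b t ∧ ⋁ a                ≡⟨ distrib (b t) a ⟩
      ⋁ (λ s → b t ∧ a s)      ≤⟨ ⋁-least _ (λ s → ≤-trans (≤-reflexive (∧-comm (b t) (a s))) (a∧b≤z s t)) ⟩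
      z                        ∎

  ∧-preserving⇒monotone : ∀ {f : Carrier → Carrier} → (∀ x y → f (x ∧ y) ≡ f x ∧ f y) →
                          f Preserves _≤_ ⟶ _≤_
  ∧-preserving⇒monotone {f} f-∧ {x} {y} x≤y = begin
    f x             ≡⟨ cong f (x≤y⇒x∧y≡x x≤y) ⟨
    f (x ∧ y)       ≡⟨ f-∧ x y ⟩
    f x ∧ f y       ≤⟨ ∧-lowerʳ (f x) (f y) ⟩
    f y             ∎

module _ {u : Level} (X : Locale u) where
  open Locale X
  open Frame 𝒪
  open FrameProperties 𝒪

  isNucleus⇒monotone : ∀ {j} → isNucleus X j → j Preserves _≤_ ⟶ _≤_
  isNucleus⇒monotone ν = ∧-preserving⇒monotone (isNucleus.preserves-∧ ν)

  monotone⇒preserves-directed : ∀ {f} → f Preserves _≤_ ⟶ _≤_ →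
                                ∀ {I : Set u} {V : I → Carrier} → isDirected X V → isDirected X (f ∘ V)
  monotone⇒preserves-directed f-mono (inhabited , bounded) =
    inhabited , λ i j → ∥∥-map (λ { (k , i≤k , j≤k) → k , f-mono i≤k , f-mono j≤k }) (bounded i j)

  module _ {I : Set u} (k : I → Carrier → Carrier) where

    iterate-++ : ∀ s t → iterate X k (s ++ t) ≗ iterate X k t ∘ iterate X k s
    iterate-++ []      t U = refl
    iterate-++ (i ∷ s) t U = iterate-++ s t (k i U)

    iterate-monotone : (∀ i → k i Preserves _≤_ ⟶ _≤_) → ∀ s → iterate X k s Preserves _≤_ ⟶ _≤_
    iterate-monotone k-mono []      U≤V = U≤V
    iterate-monotone k-mono (i ∷ s) U≤V = iterate-monotone k-mono s (k-mono i U≤V)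

    iterate-inflationary : (∀ i U → U ≤ k i U) → ∀ s U → U ≤ iterate X k s U
    iterate-inflationary k-infl []      U = ≤-refl U
    iterate-inflationary k-infl (i ∷ s) U =
      ≤-trans (k-infl i U) (iterate-inflationary k-infl s (k i U))

    iterate-preserves-∧ : (∀ i U V → k i (U ∧ V) ≡ k i U ∧ k i V) →
                          ∀ s U V → iterate X k s (U ∧ V) ≡ iterate X k s U ∧ iterate X k s V
    iterate-preserves-∧ k-∧ []      U V = refl
    iterate-preserves-∧ k-∧ (i ∷ s) U V = begin-equality
      iterate X k s (k i (U ∧ V))                   ≡⟨ cong (iterate X k s) (k-∧ i U V) ⟩
      iterate X k s (k i U ∧ k i V)                 ≡⟨ iterate-preserves-∧ k-∧ s (k i U) (k i V) ⟩
      iterate X k s (k i U) ∧ iterate X k s (k i V) ∎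

    iterate-continuous : (∀ i → k i Preserves _≤_ ⟶ _≤_) → (∀ i → isScottContinuous X (k i)) →
                         ∀ s → isScottContinuous X (iterate X k s)
    iterate-continuous k-mono k-cont []      J V V-dir = refl
    iterate-continuous k-mono k-cont (i ∷ s) J V V-dir = begin-equality
      iterate X k s (k i (⋁ V))          ≡⟨ cong (iterate X k s) (k-cont i J V V-dir) ⟩
      iterate X k s (⋁ (k i ∘ V))        ≡⟨ iterate-continuous k-mono k-cont s J (k i ∘ V)
                                              (monotone⇒preserves-directed (k-mono i) V-dir) ⟩
      ⋁ (iterate X k s ∘ k i ∘ V)        ∎

    iterate-≼-nucleus : ∀ {j} → isNucleus X j → (∀ i → _≼_ X (k i) j) → ∀ s → _≼_ X (iterate X k s) j
    iterate-≼-nucleus ν k≼j []      U = isNucleus.inflationary ν U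
    iterate-≼-nucleus {j} ν k≼j (i ∷ s) U = begin
      iterate X k s (k i U)   ≤⟨ iterate-≼-nucleus ν k≼j s (k i U) ⟩
      j (k i U)               ≤⟨ isNucleus⇒monotone ν (k≼j i U) ⟩
      j (j U)                 ≡⟨ isNucleus.idempotent ν U ⟩
      j U                     ∎

    joinOfNuclei-upper : ∀ i → _≼_ X (k i) (joinOfNuclei X k)
    joinOfNuclei-upper i U = ⋁-upper (λ s → iterate X k s U) (i ∷ [])

    joinOfNuclei-least : ∀ {j} → isNucleus X j → (∀ i → _≼_ X (k i) j) → _≼_ X (joinOfNuclei X k) j
    joinOfNuclei-least ν k≼j U = ⋁-least _ (λ s → iterate-≼-nucleus ν k≼j s U)

    module _ (k-nucleus : ∀ i → isNucleus X (k i)) where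

      private
        k* : List I → Carrier → Carrier
        k* = iterate X k

        𝕁 : Carrier → Carrier
        𝕁 = joinOfNuclei X k

        k*-monotone : ∀ s → k* s Preserves _≤_ ⟶ _≤_
        k*-monotone = iterate-monotone (isNucleus⇒monotone ∘ k-nucleus)

        k*-inflationary : ∀ s U → U ≤ k* s U
        k*-inflationary = iterate-inflationary (isNucleus.inflationary ∘ k-nucleus)

        k*≤𝕁 : ∀ s U → k* s U ≤ 𝕁 U
        k*≤𝕁 s U = ⋁-upper (λ s → k* s U) s

      iterate-≤-++ˡ : ∀ s t U → k* s U ≤ k* (s ++ t) U
      iterate-≤-++ˡ s t U = begin
        k* s U              ≤⟨ k*-inflationary t (k* s U) ⟩
        k* t (k* s U)       ≡⟨ iterate-++ s t U ⟨
        k* (s ++ t) U       ∎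

      iterate-≤-++ʳ : ∀ s t U → k* t U ≤ k* (s ++ t) U
      iterate-≤-++ʳ s t U = begin
        k* t U              ≤⟨ k*-monotone t (k*-inflationary s U) ⟩
        k* t (k* s U)       ≡⟨ iterate-++ s t U ⟨
        k* (s ++ t) U       ∎

      iterate-directed : ∀ U → isDirected X (λ s → k* s U)
      iterate-directed U =
        ∣ [] ∣ , λ s t → ∣ s ++ t , iterate-≤-++ˡ s t U , iterate-≤-++ʳ s t U ∣

      joinOfNuclei-monotone : 𝕁 Preserves _≤_ ⟶ _≤_
      joinOfNuclei-monotone U≤V = ⋁-mono (λ s → k*-monotone s U≤V)

      joinOfNuclei-preserves-∧ : ∀ U V → 𝕁 (U ∧ V) ≡ 𝕁 U ∧ 𝕁 V
      joinOfNuclei-preserves-∧ U V = ≤-antisym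
        (∧-greatest (joinOfNuclei-monotone (∧-lowerˡ U V)) (joinOfNuclei-monotone (∧-lowerʳ U V)))
        (⋁-∧-⋁-least _ _ meet≤𝕁)
        where
        meet≤𝕁 : ∀ s t → k* s U ∧ k* t V ≤ 𝕁 (U ∧ V)
        meet≤𝕁 s t = begin
          k* s U ∧ k* t V                  ≤⟨ ∧-mono (iterate-≤-++ˡ s t U) (iterate-≤-++ʳ s t V) ⟩
          k* (s ++ t) U ∧ k* (s ++ t) V    ≡⟨ iterate-preserves-∧ (isNucleus.preserves-∧ ∘ k-nucleus) (s ++ t) U V ⟨
          k* (s ++ t) (U ∧ V)              ≤⟨ k*≤𝕁 (s ++ t) (U ∧ V) ⟩
          𝕁 (U ∧ V)                        ∎

      module _ (k-continuous : ∀ i → isScottContinuous X (k i)) where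

        private
          k*-continuous : ∀ s → isScottContinuous X (k* s)
          k*-continuous = iterate-continuous (isNucleus⇒monotone ∘ k-nucleus) k-continuous

        joinOfNuclei-idempotent : ∀ U → 𝕁 (𝕁 U) ≡ 𝕁 U
        joinOfNuclei-idempotent U = ≤-antisym (⋁-least _ k*𝕁≤𝕁) (k*≤𝕁 [] (𝕁 U))
          where
          k*𝕁≤𝕁 : ∀ t → k* t (𝕁 U) ≤ 𝕁 U
          k*𝕁≤𝕁 t = begin
            k* t (𝕁 U)                   ≡⟨ k*-continuous t _ _ (iterate-directed U) ⟩
            ⋁ (λ s → k* t (k* s U))      ≤⟨ ⋁-least _ (λ s → ≤-trans (≤-reflexive (sym (iterate-++ s t U)))
                                                                      (k*≤𝕁 (s ++ t) U)) ⟩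
            𝕁 U                          ∎

        joinOfNuclei-isNucleus : isNucleus X 𝕁
        joinOfNuclei-isNucleus = record
          { inflationary = k*≤𝕁 []
          ; preserves-∧  = joinOfNuclei-preserves-∧
          ; idempotent   = joinOfNuclei-idempotent
          }

        joinOfNuclei-isScottContinuous : isScottContinuous X 𝕁
        joinOfNuclei-isScottContinuous J V V-dir = ≤-antisym
          (⋁-least _ k*⋁≤⋁𝕁)
          (⋁-least _ (λ i → joinOfNuclei-monotone (⋁-upper V i)))
          where
          k*⋁≤⋁𝕁 : ∀ s → k* s (⋁ V) ≤ ⋁ (𝕁 ∘ V)
          k*⋁≤⋁𝕁 s = begin
            k* s (⋁ V)         ≡⟨ k*-continuous s J V V-dir ⟩
            ⋁ (k* s ∘ V)       ≤⟨ ⋁-mono (λ i → k*≤𝕁 s (V i)) ⟩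
            ⋁ (𝕁 ∘ V)          ∎

mainTheorem9 : {u : Level} (X : Locale u) → isSpectral X →
    (I : Set u) (k : I → ScottContinuousNucleus X) →
    isNucleus X (joinOfNuclei X (λ i → ScottContinuousNucleus.fun (k i)))
    × isScottContinuous X (joinOfNuclei X (λ i → ScottContinuousNucleus.fun (k i)))
    × (∀ i → _≼_ X (ScottContinuousNucleus.fun (k i)) (joinOfNuclei X (λ i → ScottContinuousNucleus.fun (k i))))
    × ((j : ScottContinuousNucleus X) →
        (∀ i → _≼_ X (ScottContinuousNucleus.fun (k i)) (ScottContinuousNucleus.fun j)) →
        _≼_ X (joinOfNuclei X (λ i → ScottContinuousNucleus.fun (k i))) (ScottContinuousNucleus.fun j))
mainTheorem9 X _ I k =
    joinOfNuclei-isNucleus X K K-nucleus K-continuous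
  , joinOfNuclei-isScottContinuous X K K-nucleus K-continuous
  , joinOfNuclei-upper X K
  , λ j → joinOfNuclei-least X K (ScottContinuousNucleus.nucleus j)
  where
  open ScottContinuousNucleus using (fun; nucleus; continuous)

  K : I → Frame.Carrier (Locale.𝒪 X) → Frame.Carrier (Locale.𝒪 X)
  K i = fun (k i)

  K-nucleus : ∀ i → isNucleus X (K i)
  K-nucleus i = nucleus (k i)

  K-continuous : ∀ i → isScottContinuous X (K i)
  K-continuous i = continuous (k i)
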